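{- Let $P(X)=\sum_{i=0}^d\alpha_iX^i\in\mathbb{Z}[X]$ be a monic polynomial of degree $d\ge2$ with $P(\mathbb{N}_0)\subseteq\mathbb{N}_0$, and let $\mu\ge1$ be an integer. There exist a constant $C>0$ and an integer $k_0$ such that for all integers $k\ge k_0$, all integers $r>1$, and all integers $n$ with $C<n<F_{\mu k}$, \[ s_Z\big(P(n+L_{2d\mu k+2})\big)=s_Z\big(P(n+L_{2d\mu k+2r})\big). \]
   Context: $\mathbb{N}_0=\{0,1,2,\dots\}$. Fibonacci numbers: $F_0=0$, $F_1=1$, $F_{n+2}=F_{n+1}+F_n$. Lucas numbers: $L_0=2$, $L_1=1$, $L_{j+2}=L_{j+1}+L_j$. Every integer $n\ge 0$ has a unique Zeckendorf representation $n=\sum_{i\ge0}\varepsilon_i(n)F_{i+2}$ with $\varepsilon_i(n)\in\{0,1\}$ and $\varepsilon_i(n)\varepsilon_{i+1}(n)=0$ for all $i$; $s_Z(n)=\sum_{i\ge0}\varepsilon_i(n)$. -}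

module Defs where

open import Data.Nat using (ℕ; zero; suc; _+_; _∸_; _≤ᵇ_)
open import Data.Bool using (if_then_else_)
open import Data.Integer as ℤ using (ℤ)
open import Data.Vec using (Vec; []; _∷_)

fib : ℕ → ℕ
fib zero = 0
fib (suc zero) = 1
fib (suc (suc n)) = fib (suc n) + fib n

lucas : ℕ → ℕ
lucas zero = 2
lucas (suc zero) = 1
lucas (suc (suc n)) = lucas (suc n) + lucas n

evalPoly : ∀ {m} → Vec ℤ m → ℤ → ℤ
evalPoly [] x = ℤ.0ℤ
evalPoly (a ∷ as) x = a ℤ.+ x ℤ.* evalPoly as x

-- Zeckendorf sum of digits s_Z, computed by the greedy algorithm, which
-- produces exactly the (unique) Zeckendorf representation
-- n = sum ε_i F_{i+2}, ε_i ε_{i+1} = 0: repeatedly subtract the largest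
-- Fibonacci number F_j (j ≥ 2) not exceeding the remainder, counting steps.

-- largest Fibonacci number ≤ m (for m ≥ 1); a, b are consecutive Fibonacci
-- numbers F_j, F_{j+1} with a ≤ m; the fuel argument bounds the iteration.
largestFibGo : ℕ → ℕ → ℕ → ℕ → ℕ
largestFibGo zero m a b = a
largestFibGo (suc f) m a b = if b ≤ᵇ m then largestFibGo f m b (a + b) else a

largestFib : ℕ → ℕ
largestFib m = largestFibGo m m 1 2

sZGo : ℕ → ℕ → ℕ
sZGo zero m = 0
sZGo (suc f) zero = 0
sZGo (suc f) (suc m) = suc (sZGo f (suc m ∸ largestFib (suc m)))

sZ : ℕ → ℕ
sZ n = sZGo n n

{-# OPTIONS --safe #-}
-- Write y = 2j. For even y, L_y·L_{sy} = L_{(s+1)y} + L_{(s−1)y}, so Horner's scheme expands P(n + L_y)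
-- as h₀ + Σ_{1≤s≤d} h_s·L_{sy} with integer coefficients h_s depending on α and n but not on y; for
-- n > Σ|αᵢ| they are nonnegative with h_s ≤ K·n^{d−s}, hence h_s ≤ F_{t_s} for t_s = c + (d − s)·a once n < F_a.
-- By d'Ocagne's identity, if g ≤ F_t then raising every index of the Zeckendorf representation of
-- g·L_{3+t} by u gives the one of g·L_{3+t+u}. So the Zeckendorf digits of h_s·L_{sy} are those of
-- h_s·L_{3+t_s}, moved to within t_s + 3 of the index sy; for y ≥ 2da + 2 these blocks neither overlap
-- nor touch, and s_Z(P(n + L_y)) = s_Z(h₀) + Σ_{s≥1} s_Z(h_s·L_{3+t_s}) is the same for all such y.
module Submission where

open import Defs

module Fibonacci where

  open import Data.Nat
  open import Data.Nat.Properties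
  open import Function.Base using (_∘_)
  open import Relation.Binary.PropositionalEquality
  open import Data.Nat.Tactic.RingSolver using (solve-∀)

  fib≤fib-suc : ∀ n → fib n ≤ fib (suc n)
  fib≤fib-suc zero = z≤n
  fib≤fib-suc (suc n) = m≤m+n (fib (suc n)) (fib n)

  fib-mono-≤ : ∀ {m n} → m ≤ n → fib m ≤ fib n
  fib-mono-≤ = go ∘ ≤⇒≤′
    where
    go : ∀ {m n} → m ≤′ n → fib m ≤ fib n
    go ≤′-refl = ≤-refl
    go {n = suc n} (≤′-step m≤′n) = ≤-trans (go m≤′n) (fib≤fib-suc n)

  0<fib-suc : ∀ n → 0 < fib (suc n)
  0<fib-suc zero = s≤s z≤n
  0<fib-suc (suc n) = ≤-trans (0<fib-suc n) (m≤m+n (fib (suc n)) (fib n))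

  fib-mono-< : ∀ {m n} → 2 ≤ m → m < n → fib m < fib n
  fib-mono-< {suc zero} (s≤s ())
  fib-mono-< {suc (suc m)} _ m<n =
    <-≤-trans (m<m+n (fib (2 + m)) (0<fib-suc m)) (fib-mono-≤ m<n)

  n≤fib[2+n] : ∀ n → n ≤ fib (2 + n)
  n≤fib[2+n] zero = z≤n
  n≤fib[2+n] (suc n) =
    subst (_≤ fib (2 + n) + fib (suc n)) (+-comm n 1) (+-mono-≤ (n≤fib[2+n] n) (0<fib-suc n))

  fib-+ : ∀ a b → fib (suc (a + b)) ≡ fib (suc a) * fib (suc b) + fib a * fib b
  fib-+ zero b = sym (trans (+-identityʳ _) (+-identityʳ _))
  fib-+ (suc zero) b = ring (fib (suc b)) (fib b)
    where
    ring : ∀ x y → x + y ≡ (x + 0) + (y + 0)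
    ring = solve-∀
  fib-+ (suc (suc a)) b
    rewrite fib-+ (suc a) b | fib-+ a b = ring (fib (2 + a)) (fib (suc a)) (fib a) (fib (suc b)) (fib b)
    where
    ring : ∀ p q r x y → (p * x + q * y) + (q * x + r * y) ≡ (p + q) * x + (q + r) * y
    ring = solve-∀

  fib*fib≤fib-+ : ∀ a b → fib a * fib (suc b) ≤ fib (a + b)
  fib*fib≤fib-+ zero b = z≤n
  fib*fib≤fib-+ (suc a) b rewrite fib-+ a b = m≤m+n _ _

  fib^≤fib : ∀ a m → fib a ^ m ≤ fib (suc (m * a))
  fib^≤fib a zero = ≤-refl
  fib^≤fib a (suc m) = begin
    fib a * fib a ^ m                  ≤⟨ *-monoʳ-≤ (fib a) (fib^≤fib a m) ⟩
    fib a * fib (suc (m * a))          ≤⟨ *-monoˡ-≤ _ (fib≤fib-suc a) ⟩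
    fib (suc a) * fib (suc (m * a))    ≤⟨ m≤m+n _ _ ⟩
    fib (suc a) * fib (suc (m * a)) + fib a * fib (m * a) ≡⟨ fib-+ a (m * a) ⟨
    fib (suc (a + m * a))              ∎
    where open ≤-Reasoning

  lucas-suc≡fib+fib : ∀ m → lucas (suc m) ≡ fib m + fib (2 + m)
  lucas-suc≡fib+fib zero = refl
  lucas-suc≡fib+fib (suc zero) = refl
  lucas-suc≡fib+fib (suc (suc m))
    rewrite lucas-suc≡fib+fib (suc m) | lucas-suc≡fib+fib m = ring (fib (suc m)) (fib m)
    where
    ring : ∀ b c → (b + ((b + c) + b)) + (c + (b + c)) ≡ (b + c) + (((b + c) + b) + (b + c))
    ring = solve-∀

  lucas-suc≤fib : ∀ m → lucas (suc m) ≤ fib (3 + m)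
  lucas-suc≤fib m rewrite lucas-suc≡fib+fib m =
    subst (fib m + fib (2 + m) ≤_) (+-comm (fib (suc m)) _) (+-monoˡ-≤ _ (fib≤fib-suc m))

  lucas+fib≡2*fib-suc : ∀ m → lucas m + fib m ≡ 2 * fib (suc m)
  lucas+fib≡2*fib-suc zero = refl
  lucas+fib≡2*fib-suc (suc m) rewrite lucas-suc≡fib+fib m = ring (fib (suc m)) (fib m)
    where
    ring : ∀ b c → (c + (b + c)) + b ≡ 2 * (b + c)
    ring = solve-∀

module Zeckendorf where

  open Fibonacci
  open import Data.Nat
  open import Data.Nat.Properties
  open import Function.Base using (_∘_)
  open import Data.Bool using (true; false)
  open import Data.List using (List; []; _∷_; length; map; _++_)
  open import Data.List.Properties using (map-++)
  open import Data.Nat.ListAction.Properties using (sum-++)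
  open import Data.Nat.ListAction using (sum)
  open import Data.Product using (Σ; _×_; _,_)
  open import Relation.Nullary using (yes; no; ofʸ; ofⁿ; contradiction)
  open import Relation.Binary.PropositionalEquality

  fibSum : List ℕ → ℕ
  fibSum S = sum (map fib S)

  -- S lists, largest first, the indices i = j + 2 with εⱼ = 1 of a Zeckendorf representation;
  -- p bounds the largest one by i + 2 ≤ p.
  data Zeckendorf (p : ℕ) : List ℕ → Set where
    [] : Zeckendorf p []
    cons : ∀ {i S} → 2 ≤ i → 2 + i ≤ p → Zeckendorf i S → Zeckendorf p (i ∷ S)

  zeckendorf-weaken : ∀ {p q S} → p ≤ q → Zeckendorf p S → Zeckendorf q S
  zeckendorf-weaken p≤q [] = []
  zeckendorf-weaken p≤q (cons 2≤i i<p zS) = cons 2≤i (≤-trans i<p p≤q) zS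

  fibSum<fib : ∀ {q S} → Zeckendorf (2 + q) S → fibSum S < fib (suc q)
  fibSum<fib {q} [] = 0<fib-suc q
  fibSum<fib {q} (cons {suc zero} (s≤s ()) _ _)
  fibSum<fib {q} (cons {suc (suc i)} _ (s≤s (s≤s 2+i≤q)) zS) =
    <-≤-trans (+-monoʳ-< (fib (2 + i)) (fibSum<fib zS)) (fib-mono-≤ (s≤s 2+i≤q))

  Representable : ℕ → Set
  Representable i = ∀ m → m < fib i → Σ (List ℕ) λ S → Zeckendorf (suc i) S × fibSum S ≡ m

  representable-3+ : ∀ i → Representable (2 + i) → Representable (suc i) → Representable (3 + i)
  representable-3+ i rep₂₊ᵢ rep₁₊ᵢ m m<F with m <? fib (2 + i)
  ... | yes m<F₂₊ᵢ =
    let S , zS , fibSum≡ = rep₂₊ᵢ m m<F₂₊ᵢ in S , zeckendorf-weaken (n≤1+n _) zS , fibSum≡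
  ... | no m≮F₂₊ᵢ =
    let S , zS , fibSum≡ = rep₁₊ᵢ (m ∸ fib (2 + i)) rest<F
    in 2 + i ∷ S , cons (s≤s (s≤s z≤n)) ≤-refl zS , trans (cong (fib (2 + i) +_) fibSum≡) m≡
    where
    m≡ : fib (2 + i) + (m ∸ fib (2 + i)) ≡ m
    m≡ = m+[n∸m]≡n (≮⇒≥ m≮F₂₊ᵢ)
    rest<F : m ∸ fib (2 + i) < fib (suc i)
    rest<F = +-cancelˡ-< (fib (2 + i)) _ _ (subst (_< fib (3 + i)) (sym m≡) m<F)

  zeckendorf-exists : ∀ i → Representable i
  zeckendorf-exists (suc zero) zero _ = [] , [] , refl
  zeckendorf-exists (suc (suc zero)) zero _ = [] , [] , refl
  zeckendorf-exists (suc zero) (suc m) (s≤s ())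
  zeckendorf-exists (suc (suc zero)) (suc m) (s≤s ())
  zeckendorf-exists (suc (suc (suc i))) =
    representable-3+ i (zeckendorf-exists (suc (suc i))) (zeckendorf-exists (suc i))

  largestFibGo-fib : ∀ f j δ m → δ ≤ f → fib (j + δ) ≤ m → m < fib (suc (j + δ))
                   → largestFibGo f m (fib j) (fib (suc j)) ≡ fib (j + δ)
  largestFibGo-fib zero j zero m _ _ _ = cong fib (sym (+-identityʳ j))
  largestFibGo-fib (suc f) j zero m _ _ m<F
    with fib (suc j) ≤ᵇ m | ≤ᵇ-reflects-≤ (fib (suc j)) m
  ... | true | ofʸ F≤m = contradiction (subst (λ k → fib (suc k) ≤ m) (sym (+-identityʳ j)) F≤m) (<⇒≱ m<F)
  ... | false | _ = cong fib (sym (+-identityʳ j))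
  largestFibGo-fib (suc f) j (suc δ) m (s≤s δ≤f) F≤m m<F
    with fib (suc j) ≤ᵇ m | ≤ᵇ-reflects-≤ (fib (suc j)) m
  ... | true | _ =
    trans (cong (largestFibGo f m (fib (suc j))) (+-comm (fib j) (fib (suc j))))
      (trans (largestFibGo-fib f (suc j) δ m δ≤f F≤m′ m<F′) (cong fib (sym (+-suc j δ))))
    where
    F≤m′ : fib (suc j + δ) ≤ m
    F≤m′ = subst (λ k → fib k ≤ m) (+-suc j δ) F≤m
    m<F′ : m < fib (suc (suc j + δ))
    m<F′ = subst (λ k → m < fib (suc k)) (+-suc j δ) m<F
  ... | false | ofⁿ F≰m =
    contradiction (≤-trans (fib-mono-≤ (subst (suc j ≤_) (sym (+-suc j δ)) (s≤s (m≤m+n j δ)))) F≤m) F≰m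

  largestFib-fibSum : ∀ {p i S} → Zeckendorf p (i ∷ S) → largestFib (fibSum (i ∷ S)) ≡ fib i
  largestFib-fibSum {i = suc zero} (cons (s≤s ()) _ _)
  largestFib-fibSum {i = suc (suc i)} {S} (cons _ _ zS) =
    largestFibGo-fib (fibSum (2 + i ∷ S)) 2 i (fibSum (2 + i ∷ S))
      (≤-trans (n≤fib[2+n] i) (m≤m+n _ _)) (m≤m+n _ _) (+-monoʳ-< (fib (2 + i)) (fibSum<fib zS))

  sZGo-suc : ∀ f x → 0 < x → sZGo (suc f) x ≡ suc (sZGo f (x ∸ largestFib x))
  sZGo-suc f (suc x) _ = refl

  sZGo-fibSum : ∀ f {p S} → Zeckendorf p S → fibSum S ≤ f → sZGo f (fibSum S) ≡ length S
  sZGo-fibSum zero [] _ = refl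
  sZGo-fibSum (suc f) [] _ = refl
  sZGo-fibSum f (cons {suc zero} (s≤s ()) _ _) _
  sZGo-fibSum zero (cons {suc (suc i)} _ _ _) F≤0 = contradiction F≤0 (<⇒≱ (≤-trans (0<fib-suc (suc i)) (m≤m+n _ _)))
  sZGo-fibSum (suc f) {S = i ∷ S} z@(cons {suc (suc i′)} _ _ zS) F≤f = begin
    sZGo (suc f) (fib i + fibSum S)
      ≡⟨ sZGo-suc f _ (≤-trans (0<fib-suc (suc i′)) (m≤m+n _ _)) ⟩
    suc (sZGo f (fib i + fibSum S ∸ largestFib (fib i + fibSum S)))
      ≡⟨ cong (λ x → suc (sZGo f (fib i + fibSum S ∸ x))) (largestFib-fibSum z) ⟩
    suc (sZGo f (fib i + fibSum S ∸ fib i))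
      ≡⟨ cong (suc ∘ sZGo f) (m+n∸m≡n (fib i) (fibSum S)) ⟩
    suc (sZGo f (fibSum S))
      ≡⟨ cong suc (sZGo-fibSum f zS F≤f′) ⟩
    suc (length S)
      ∎
    where
    open ≡-Reasoning
    F≤f′ : fibSum S ≤ f
    F≤f′ = ≤-pred (≤-trans (+-monoˡ-≤ (fibSum S) (0<fib-suc (suc i′))) F≤f)

  sZ-fibSum : ∀ {p S} → Zeckendorf p S → sZ (fibSum S) ≡ length S
  sZ-fibSum zS = sZGo-fibSum _ zS ≤-refl

  fibSum-++ : ∀ S₁ S₂ → fibSum (S₁ ++ S₂) ≡ fibSum S₁ + fibSum S₂
  fibSum-++ S₁ S₂ = trans (cong sum (map-++ fib S₁ S₂)) (sum-++ (map fib S₁) (map fib S₂))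

  2+i≤p⇒2+[u+i]≤u+p : ∀ u {i p} → 2 + i ≤ p → 2 + (u + i) ≤ u + p
  2+i≤p⇒2+[u+i]≤u+p u {i} {p} 2+i≤p =
    subst (_≤ u + p) (trans (+-suc u (suc i)) (cong suc (+-suc u i))) (+-monoʳ-≤ u 2+i≤p)

  zeckendorf-map-+ : ∀ {p S} u → Zeckendorf p S → Zeckendorf (u + p) (map (u +_) S)
  zeckendorf-map-+ u [] = []
  zeckendorf-map-+ u (cons {i} 2≤i 2+i≤p zS) =
    cons (≤-trans 2≤i (m≤n+m i u)) (2+i≤p⇒2+[u+i]≤u+p u 2+i≤p) (zeckendorf-map-+ u zS)

  zeckendorf-shift-++ : ∀ {p q S₁ S₂} → 2 ≤ p → Zeckendorf p S₁ → Zeckendorf (2 + q) S₂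
                      → Zeckendorf (q + p) (map (q +_) S₁ ++ S₂)
  zeckendorf-shift-++ {p} {q} 2≤p [] zS₂ = zeckendorf-weaken (subst (_≤ q + p) (+-comm q 2) (+-monoʳ-≤ q 2≤p)) zS₂
  zeckendorf-shift-++ {q = q} _ (cons {i} 2≤i 2+i≤p zS₁) zS₂ =
    cons (≤-trans 2≤i (m≤n+m i q)) (2+i≤p⇒2+[u+i]≤u+p q 2+i≤p) (zeckendorf-shift-++ 2≤i zS₁ zS₂)

  n<m⇒m∸n≡1+[m∸1+n] : ∀ {m n} → n < m → m ∸ n ≡ suc (m ∸ suc n)
  n<m⇒m∸n≡1+[m∸1+n] {suc m} {zero} _ = refl
  n<m⇒m∸n≡1+[m∸1+n] {suc m} {suc n} (s≤s n<m) = n<m⇒m∸n≡1+[m∸1+n] n<m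

  -- The Zeckendorf bound read from the other end: along S the indices N ∸ i increase with gaps ≥ 2,
  -- so the running sum acc of the terms already passed stays below F (1 + N ∸ p).
  fibSum-reflect< : ∀ {N p S} acc → Zeckendorf p S → 2 ≤ p → p ≤ N → acc < fib (suc (N ∸ p))
                  → acc + fibSum (map (N ∸_) S) < fib (suc (N ∸ 2))
  fibSum-reflect< {N} acc [] 2≤p p≤N acc<F =
    subst (_< fib (suc (N ∸ 2))) (sym (+-identityʳ acc)) (<-≤-trans acc<F (fib-mono-≤ (s≤s (∸-monoʳ-≤ N 2≤p))))
  fibSum-reflect< {N} acc (cons {i} {S} 2≤i 2+i≤p zS) 2≤p p≤N acc<F =
    subst (_< fib (suc (N ∸ 2))) (+-assoc acc (fib (N ∸ i)) _)
      (fibSum-reflect< (acc + fib (N ∸ i)) zS 2≤i (≤-trans (≤-trans (m≤n+m i 2) 2+i≤p) p≤N) acc′<F)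
    where
    2+i≤N = ≤-trans 2+i≤p p≤N
    acc′<F : acc + fib (N ∸ i) < fib (suc (N ∸ i))
    acc′<F rewrite n<m⇒m∸n≡1+[m∸1+n] (≤-trans (n≤1+n _) 2+i≤N) | n<m⇒m∸n≡1+[m∸1+n] 2+i≤N =
      subst (acc + fib (2 + (N ∸ (2 + i))) <_) (+-comm (fib (suc (N ∸ (2 + i)))) _)
        (+-monoˡ-< _ (<-≤-trans acc<F (fib-mono-≤ (s≤s (∸-monoʳ-≤ N 2+i≤p)))))

module FibonacciIdentities where

  open Fibonacci
  open import Data.Nat as ℕ using (ℕ; zero; suc)
  import Data.Nat.Properties as ℕ
  open import Data.Integer using (ℤ; +_; -_; _+_; _-_; _*_; _^_; -1ℤ; 1ℤ; ∣_∣)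
  open import Data.Integer.Properties
  open import Data.Integer.Tactic.RingSolver using (solve-∀)
  open import Relation.Binary.PropositionalEquality

  fibℤ lucasℤ : ℕ → ℤ
  fibℤ n = + fib n
  lucasℤ n = + lucas n

  FibonacciLike : (ℕ → ℤ) → Set
  FibonacciLike G = ∀ n → G (2 ℕ.+ n) ≡ G (suc n) + G n

  fibℤ-fibonacciLike : FibonacciLike fibℤ
  fibℤ-fibonacciLike n = pos-+ (fib (suc n)) (fib n)

  lucasℤ-fibonacciLike : FibonacciLike lucasℤ
  lucasℤ-fibonacciLike n = pos-+ (lucas (suc n)) (lucas n)

  ∣-1^n*i∣≡∣i∣ : ∀ n i → ∣ -1ℤ ^ n * i ∣ ≡ ∣ i ∣
  ∣-1^n*i∣≡∣i∣ zero i = cong ∣_∣ (*-identityˡ i)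
  ∣-1^n*i∣≡∣i∣ (suc n) i = begin
    ∣ -1ℤ * -1ℤ ^ n * i ∣     ≡⟨ cong ∣_∣ (trans (*-assoc -1ℤ (-1ℤ ^ n) i) (-1*i≡-i (-1ℤ ^ n * i))) ⟩
    ∣ - (-1ℤ ^ n * i) ∣       ≡⟨ ∣-i∣≡∣i∣ (-1ℤ ^ n * i) ⟩
    ∣ -1ℤ ^ n * i ∣           ≡⟨ ∣-1^n*i∣≡∣i∣ n i ⟩
    ∣ i ∣                     ∎
    where open ≡-Reasoning

  -1^even≡1 : ∀ j → -1ℤ ^ (2 ℕ.* j) ≡ 1ℤ
  -1^even≡1 j = trans (sym (^-*-assoc -1ℤ 2 j)) (^-zeroˡ j)

  fib-cross : ∀ G → FibonacciLike G → ∀ i m →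
    fibℤ (i ℕ.+ m) * G (suc i) - fibℤ (suc (i ℕ.+ m)) * G i ≡ -1ℤ ^ i * (fibℤ m * G 1 - fibℤ (suc m) * G 0)
  fib-cross G G-rec zero m = sym (*-identityˡ _)
  fib-cross G G-rec (suc i) m = begin
    fibℤ (suc (i ℕ.+ m)) * G (2 ℕ.+ i) - fibℤ (2 ℕ.+ (i ℕ.+ m)) * G (suc i)
      ≡⟨ cong₂ (λ u v → fibℤ (suc (i ℕ.+ m)) * u - v * G (suc i)) (G-rec i) (fibℤ-fibonacciLike (i ℕ.+ m)) ⟩
    fibℤ (suc (i ℕ.+ m)) * (G (suc i) + G i) - (fibℤ (suc (i ℕ.+ m)) + fibℤ (i ℕ.+ m)) * G (suc i)
      ≡⟨ ring (fibℤ (i ℕ.+ m)) (fibℤ (suc (i ℕ.+ m))) (G (suc i)) (G i) ⟩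
    - (fibℤ (i ℕ.+ m) * G (suc i) - fibℤ (suc (i ℕ.+ m)) * G i)
      ≡⟨ cong -_ (fib-cross G G-rec i m) ⟩
    - (-1ℤ ^ i * X)
      ≡⟨ trans (*-assoc -1ℤ (-1ℤ ^ i) X) (-1*i≡-i _) ⟨
    -1ℤ ^ suc i * X
      ∎
    where
    open ≡-Reasoning
    X = fibℤ m * G 1 - fibℤ (suc m) * G 0
    ring : ∀ a b c d → b * (c + d) - (b + a) * c ≡ - (a * c - b * d)
    ring = solve-∀

  ∣fib-cross∣ : ∀ i m → ∣ fibℤ (i ℕ.+ m) * fibℤ (suc i) - fibℤ (suc (i ℕ.+ m)) * fibℤ i ∣ ≡ fib m
  ∣fib-cross∣ i m = begin
    ∣ fibℤ (i ℕ.+ m) * fibℤ (suc i) - fibℤ (suc (i ℕ.+ m)) * fibℤ i ∣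
      ≡⟨ cong ∣_∣ (fib-cross fibℤ fibℤ-fibonacciLike i m) ⟩
    ∣ -1ℤ ^ i * (fibℤ m * 1ℤ - fibℤ (suc m) * + 0) ∣
      ≡⟨ ∣-1^n*i∣≡∣i∣ i _ ⟩
    ∣ fibℤ m * 1ℤ - fibℤ (suc m) * + 0 ∣
      ≡⟨ cong ∣_∣ (ring (fibℤ m) (fibℤ (suc m))) ⟩
    fib m
      ∎
    where
    open ≡-Reasoning
    ring : ∀ a b → a * 1ℤ - b * + 0 ≡ a
    ring = solve-∀

  ∣lucas-cross∣ : ∀ i m → ∣ fibℤ (i ℕ.+ m) * lucasℤ (suc i) - fibℤ (suc (i ℕ.+ m)) * lucasℤ i ∣ ≡ lucas m
  ∣lucas-cross∣ i m = begin
    ∣ fibℤ (i ℕ.+ m) * lucasℤ (suc i) - fibℤ (suc (i ℕ.+ m)) * lucasℤ i ∣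
      ≡⟨ cong ∣_∣ (fib-cross lucasℤ lucasℤ-fibonacciLike i m) ⟩
    ∣ -1ℤ ^ i * (fibℤ m * 1ℤ - fibℤ (suc m) * + 2) ∣
      ≡⟨ ∣-1^n*i∣≡∣i∣ i _ ⟩
    ∣ fibℤ m * 1ℤ - fibℤ (suc m) * + 2 ∣
      ≡⟨ cong (λ x → ∣ fibℤ m * 1ℤ - x ∣) 2F≡L+F ⟩
    ∣ fibℤ m * 1ℤ - (lucasℤ m + fibℤ m) ∣
      ≡⟨ cong ∣_∣ (ring (lucasℤ m) (fibℤ m)) ⟩
    ∣ - lucasℤ m ∣
      ≡⟨ ∣-i∣≡∣i∣ (lucasℤ m) ⟩
    lucas m
      ∎
    where
    open ≡-Reasoning
    2F≡L+F : fibℤ (suc m) * + 2 ≡ lucasℤ m + fibℤ m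
    2F≡L+F = trans (sym (pos-* (fib (suc m)) 2))
               (trans (cong +_ (trans (ℕ.*-comm (fib (suc m)) 2) (sym (lucas+fib≡2*fib-suc m))))
                 (pos-+ (lucas m) (fib m)))
    ring : ∀ l f → f * 1ℤ - (l + f) ≡ - l
    ring = solve-∀

  lucas*lucas : ∀ a c → lucasℤ a * lucasℤ (a ℕ.+ c) ≡ lucasℤ (a ℕ.+ (a ℕ.+ c)) + -1ℤ ^ a * lucasℤ c
  lucas*lucas zero c = ring (lucasℤ c)
    where
    ring : ∀ l → + 2 * l ≡ l + 1ℤ * l
    ring = solve-∀
  lucas*lucas (suc zero) c rewrite lucasℤ-fibonacciLike c = ring (lucasℤ (suc c)) (lucasℤ c)
    where
    ring : ∀ l l′ → 1ℤ * l ≡ (l + l′) + (-1ℤ * 1ℤ) * l′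
    ring = solve-∀
  lucas*lucas (suc (suc a)) c = begin
    lucasℤ (2 ℕ.+ a) * lucasℤ (2 ℕ.+ (a ℕ.+ c))
      ≡⟨ cong (_* lucasℤ (2 ℕ.+ (a ℕ.+ c))) (lucasℤ-fibonacciLike a) ⟩
    (lucasℤ (suc a) + lucasℤ a) * lucasℤ (2 ℕ.+ (a ℕ.+ c))
      ≡⟨ *-distribʳ-+ (lucasℤ (2 ℕ.+ (a ℕ.+ c))) (lucasℤ (suc a)) (lucasℤ a) ⟩
    lucasℤ (suc a) * lucasℤ (2 ℕ.+ (a ℕ.+ c)) + lucasℤ a * lucasℤ (2 ℕ.+ (a ℕ.+ c))
      ≡⟨ cong₂ _+_ (reindex₁ (lucas*lucas (suc a) (suc c))) (reindex₀ (lucas*lucas a (2 ℕ.+ c))) ⟩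
    (lucasℤ (suc k) + -1ℤ * σ * lucasℤ (suc c)) + (lucasℤ k + σ * lucasℤ (2 ℕ.+ c))
      ≡⟨ cong (λ u → (lucasℤ (suc k) + -1ℤ * σ * lucasℤ (suc c)) + (lucasℤ k + σ * u)) (lucasℤ-fibonacciLike c) ⟩
    (lucasℤ (suc k) + -1ℤ * σ * lucasℤ (suc c)) + (lucasℤ k + σ * (lucasℤ (suc c) + lucasℤ c))
      ≡⟨ ring (lucasℤ (suc k)) (lucasℤ k) σ (lucasℤ (suc c)) (lucasℤ c) ⟩
    (lucasℤ (suc k) + lucasℤ k) + -1ℤ * (-1ℤ * σ) * lucasℤ c
      ≡⟨ cong (_+ -1ℤ ^ (2 ℕ.+ a) * lucasℤ c) (lucasℤ-fibonacciLike k) ⟨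
    lucasℤ (2 ℕ.+ k) + -1ℤ ^ (2 ℕ.+ a) * lucasℤ c
      ∎
    where
    open ≡-Reasoning
    σ = -1ℤ ^ a
    k = a ℕ.+ (2 ℕ.+ (a ℕ.+ c))
    a+[2+c] : a ℕ.+ (2 ℕ.+ c) ≡ 2 ℕ.+ (a ℕ.+ c)
    a+[2+c] = trans (ℕ.+-suc a (suc c)) (cong suc (ℕ.+-suc a c))
    reindex₁ : lucasℤ (suc a) * lucasℤ (suc a ℕ.+ suc c) ≡ lucasℤ (suc a ℕ.+ (suc a ℕ.+ suc c)) + -1ℤ * σ * lucasℤ (suc c)
             → lucasℤ (suc a) * lucasℤ (2 ℕ.+ (a ℕ.+ c)) ≡ lucasℤ (suc k) + -1ℤ * σ * lucasℤ (suc c)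
    reindex₁ = subst₂ (λ u v → lucasℤ (suc a) * lucasℤ u ≡ lucasℤ (suc (a ℕ.+ v)) + -1ℤ * σ * lucasℤ (suc c))
                      (cong suc (ℕ.+-suc a c)) (cong suc (ℕ.+-suc a c))
    reindex₀ : lucasℤ a * lucasℤ (a ℕ.+ (2 ℕ.+ c)) ≡ lucasℤ (a ℕ.+ (a ℕ.+ (2 ℕ.+ c))) + σ * lucasℤ (2 ℕ.+ c)
             → lucasℤ a * lucasℤ (2 ℕ.+ (a ℕ.+ c)) ≡ lucasℤ k + σ * lucasℤ (2 ℕ.+ c)
    reindex₀ = subst₂ (λ u v → lucasℤ a * lucasℤ u ≡ lucasℤ (a ℕ.+ v) + σ * lucasℤ (2 ℕ.+ c)) a+[2+c] a+[2+c]
    ring : ∀ A B w x y → (A + (-1ℤ * w) * x) + (B + w * (x + y)) ≡ (A + B) + (-1ℤ * (-1ℤ * w)) * y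
    ring = solve-∀

module ShiftLemma where

  open Fibonacci
  open Zeckendorf
  open FibonacciIdentities
  open import Data.Nat as ℕ using (ℕ; zero; suc; _∸_; z≤n; s≤s)
  import Data.Nat.Properties as ℕ
  open import Data.Integer using (+_; -_; _+_; _-_; _*_; 0ℤ; ∣_∣)
  open import Data.Integer.Properties
  open import Data.Integer.Tactic.RingSolver using (solve-∀)
  open import Data.List using (List; []; _∷_; map)
  open import Data.List.Properties using (map-id; map-∘)
  open import Data.List.Relation.Unary.All using (All; []; _∷_)
  open import Relation.Binary.PropositionalEquality

  zeckendorf-All≤ : ∀ {p N S} → Zeckendorf p S → p ℕ.≤ N → All (ℕ._≤ N) S
  zeckendorf-All≤ [] _ = []
  zeckendorf-All≤ (cons {i} _ 2+i≤p zS) p≤N = i≤N ∷ zeckendorf-All≤ zS i≤N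
    where
    i≤N = ℕ.≤-trans (ℕ.m≤n+m i 2) (ℕ.≤-trans 2+i≤p p≤N)

  ∣fibSum-cross∣≤ : ∀ {N} S → All (ℕ._≤ N) S →
    ∣ fibℤ N * + fibSum (map suc S) - fibℤ (suc N) * + fibSum S ∣ ℕ.≤ fibSum (map (N ∸_) S)
  ∣fibSum-cross∣≤ {N} [] [] = ℕ.≤-reflexive (cong ∣_∣ (ring (fibℤ N) (fibℤ (suc N))))
    where
    ring : ∀ a b → a * + 0 - b * + 0 ≡ + 0
    ring = solve-∀
  ∣fibSum-cross∣≤ {N} (i ∷ S) (i≤N ∷ S≤N) = begin
    ∣ fibℤ N * + (fib (suc i) ℕ.+ Y) - fibℤ (suc N) * + (fib i ℕ.+ X) ∣
      ≡⟨ cong ∣_∣ (trans (cong₂ (λ u v → fibℤ N * u - fibℤ (suc N) * v) (pos-+ (fib (suc i)) Y) (pos-+ (fib i) X))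
                         (ring (fibℤ N) (fibℤ (suc N)) (fibℤ (suc i)) (+ Y) (fibℤ i) (+ X))) ⟩
    ∣ (fibℤ N * fibℤ (suc i) - fibℤ (suc N) * fibℤ i) + (fibℤ N * + Y - fibℤ (suc N) * + X) ∣
      ≤⟨ ∣i+j∣≤∣i∣+∣j∣ (fibℤ N * fibℤ (suc i) - fibℤ (suc N) * fibℤ i) _ ⟩
    ∣ fibℤ N * fibℤ (suc i) - fibℤ (suc N) * fibℤ i ∣ ℕ.+ ∣ fibℤ N * + Y - fibℤ (suc N) * + X ∣
      ≤⟨ ℕ.+-mono-≤ (ℕ.≤-reflexive ∣cross-i∣) (∣fibSum-cross∣≤ S S≤N) ⟩
    fib (N ∸ i) ℕ.+ fibSum (map (N ∸_) S)
      ∎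
    where
    open ℕ.≤-Reasoning
    X = fibSum S
    Y = fibSum (map suc S)
    ∣cross-i∣ : ∣ fibℤ N * fibℤ (suc i) - fibℤ (suc N) * fibℤ i ∣ ≡ fib (N ∸ i)
    ∣cross-i∣ = subst (λ n → ∣ fibℤ n * fibℤ (suc i) - fibℤ (suc n) * fibℤ i ∣ ≡ fib (N ∸ i))
                      (ℕ.m+[n∸m]≡n i≤N) (∣fib-cross∣ i (N ∸ i))
    ring : ∀ a b c y e x → a * (c + y) - b * (e + x) ≡ (a * c - b * e) + (a * y - b * x)
    ring = solve-∀

  ∣n*i∣<n⇒i≡0 : ∀ n i → ∣ + n * i ∣ ℕ.< n → i ≡ 0ℤ
  ∣n*i∣<n⇒i≡0 n i ∣ni∣<n = ∣i∣≡0⇒i≡0 (ℕ.n<1⇒n≡0 (ℕ.*-cancelˡ-< n ∣ i ∣ 1 n*∣i∣<n*1))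
    where
    n*∣i∣<n*1 : n ℕ.* ∣ i ∣ ℕ.< n ℕ.* 1
    n*∣i∣<n*1 = subst₂ ℕ._<_ (∣i*j∣≡∣i∣*∣j∣ (+ n) i) (sym (ℕ.*-identityʳ n)) ∣ni∣<n

  -- For N = 3 + t + m with m large, d'Ocagne's identity makes both F_N·fibSum (map suc S) − F_{N+1}·fibSum S
  -- and F_N·L_{4+t} − F_{N+1}·L_{3+t} small; as fibSum S = g·L_{3+t}, the difference D of the two candidate
  -- values of fibSum (map suc S) satisfies |F_N·D| < F_N, so D = 0.
  fibSum-map-suc : ∀ {p S g t} → Zeckendorf p S → fibSum S ≡ g ℕ.* lucas (3 ℕ.+ t) → g ℕ.≤ fib t
                 → fibSum (map suc S) ≡ g ℕ.* lucas (4 ℕ.+ t)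
  fibSum-map-suc {p} {S} {g} {t} zS X≡gL g≤F =
    +-injective (trans (i-j≡0⇒i≡j (+ Y) (+ g * lucasℤ (4 ℕ.+ t)) D≡0) (sym (pos-* g (lucas (4 ℕ.+ t)))))
    where
    m = 2 ℕ.+ p
    W = suc (t ℕ.+ m)
    N = 2 ℕ.+ W
    X = fibSum S
    Y = fibSum (map suc S)
    D = + Y - + g * lucasℤ (4 ℕ.+ t)
    crossS = fibℤ N * + Y - fibℤ (suc N) * + X
    crossL = fibℤ N * lucasℤ (4 ℕ.+ t) - fibℤ (suc N) * lucasℤ (3 ℕ.+ t)
    F·D≡ : fibℤ N * D ≡ crossS - + g * crossL
    F·D≡ = trans (ring (fibℤ N) (fibℤ (suc N)) (+ Y) (+ g) (lucasℤ (4 ℕ.+ t)) (lucasℤ (3 ℕ.+ t)))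
                 (cong (λ x → fibℤ N * + Y - fibℤ (suc N) * x - + g * crossL)
                       (trans (sym (pos-* g (lucas (3 ℕ.+ t)))) (cong +_ (sym X≡gL))))
      where
      ring : ∀ a b y g l′ l → a * (y - g * l′) ≡ (a * y - b * (g * l)) - g * (a * l′ - b * l)
      ring = solve-∀
    ∣crossS∣< : ∣ crossS ∣ ℕ.< fib (suc W)
    ∣crossS∣< = ℕ.≤-<-trans (∣fibSum-cross∣≤ S (zeckendorf-All≤ zS′ m≤N))
                  (fibSum-reflect< 0 zS′ (s≤s (s≤s z≤n)) m≤N (0<fib-suc (N ∸ m)))
      where
      zS′ = zeckendorf-weaken (ℕ.m≤n+m p 2) zS
      m≤N : m ℕ.≤ N
      m≤N = ℕ.m≤n+m m (3 ℕ.+ t)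
    g·∣crossL∣≤ : ∣ + g * crossL ∣ ℕ.≤ fib W
    g·∣crossL∣≤ = begin
      ∣ + g * crossL ∣             ≡⟨ ∣i*j∣≡∣i∣*∣j∣ (+ g) crossL ⟩
      g ℕ.* ∣ crossL ∣             ≡⟨ cong (g ℕ.*_) (∣lucas-cross∣ (3 ℕ.+ t) m) ⟩
      g ℕ.* lucas m                ≤⟨ ℕ.*-mono-≤ g≤F (lucas-suc≤fib (suc p)) ⟩
      fib t ℕ.* fib (2 ℕ.+ m)      ≤⟨ fib*fib≤fib-+ t (suc m) ⟩
      fib (t ℕ.+ suc m)            ≡⟨ cong fib (ℕ.+-suc t m) ⟩
      fib W                        ∎
      where open ℕ.≤-Reasoning
    ∣F·D∣<F : ∣ fibℤ N * D ∣ ℕ.< fib N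
    ∣F·D∣<F = begin-strict
      ∣ fibℤ N * D ∣                            ≡⟨ cong ∣_∣ F·D≡ ⟩
      ∣ crossS - + g * crossL ∣                 ≤⟨ ∣i-j∣≤∣i∣+∣j∣ crossS (+ g * crossL) ⟩
      ∣ crossS ∣ ℕ.+ ∣ + g * crossL ∣           <⟨ ℕ.+-mono-<-≤ ∣crossS∣< g·∣crossL∣≤ ⟩
      fib (suc W) ℕ.+ fib W                     ≡⟨⟩
      fib N                                     ∎
      where open ℕ.≤-Reasoning
    D≡0 : D ≡ 0ℤ
    D≡0 = ∣n*i∣<n⇒i≡0 (fib N) D ∣F·D∣<F

  fibSum-map-+ : ∀ {p S g t} → Zeckendorf p S → fibSum S ≡ g ℕ.* lucas (3 ℕ.+ t) → g ℕ.≤ fib t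
               → ∀ u → fibSum (map (u ℕ.+_) S) ≡ g ℕ.* lucas (3 ℕ.+ t ℕ.+ u)
  fibSum-map-+ {S = S} {g} {t} zS X≡gL g≤F zero =
    trans (cong fibSum (map-id S)) (trans X≡gL (cong (λ k → g ℕ.* lucas (3 ℕ.+ k)) (sym (ℕ.+-identityʳ t))))
  fibSum-map-+ {S = S} {g} {t} zS X≡gL g≤F (suc u) = begin
    fibSum (map (suc u ℕ.+_) S)           ≡⟨ cong fibSum (map-∘ S) ⟩
    fibSum (map suc (map (u ℕ.+_) S))     ≡⟨ fibSum-map-suc {t = t ℕ.+ u} (zeckendorf-map-+ u zS)
                                                (fibSum-map-+ {t = t} zS X≡gL g≤F u) (ℕ.≤-trans g≤F (fib-mono-≤ (ℕ.m≤m+n t u))) ⟩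
    g ℕ.* lucas (4 ℕ.+ (t ℕ.+ u))         ≡⟨ cong (λ k → g ℕ.* lucas (3 ℕ.+ k)) (ℕ.+-suc t u) ⟨
    g ℕ.* lucas (3 ℕ.+ t ℕ.+ suc u)       ∎
    where open ≡-Reasoning

module LucasSums where

  open Fibonacci
  open Zeckendorf
  open ShiftLemma using (fibSum-map-+)
  open import Data.Nat
  open import Data.Nat.Properties
  open import Data.Nat.Tactic.RingSolver using (solve-∀)
  open import Data.List using (List; length; map; _++_)
  open import Data.List.Properties using (length-++; length-map)
  open import Data.Product using (Σ; _×_; _,_; proj₁; proj₂)
  open import Relation.Binary.PropositionalEquality

  lucasMultiple<fib : ∀ {g t} → g ≤ fib t → g * lucas (3 + t) < fib (5 + (t + t))
  lucasMultiple<fib {g} {t} g≤F = begin-strict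
    g * lucas (3 + t)          ≤⟨ *-mono-≤ g≤F (lucas-suc≤fib (2 + t)) ⟩
    fib t * fib (5 + t)        ≤⟨ fib*fib≤fib-+ t (4 + t) ⟩
    fib (t + (4 + t))          <⟨ fib-mono-< (≤-trans (s≤s (s≤s z≤n)) (m≤n+m (4 + t) t))
                                                 (≤-reflexive (cong suc (t+[4+t] t))) ⟩
    fib (5 + (t + t))          ∎
    where
    open ≤-Reasoning
    t+[4+t] : ∀ t → t + (4 + t) ≡ 4 + (t + t)
    t+[4+t] = solve-∀

  appendBlock : ∀ g t {S} u → g ≤ fib t → Zeckendorf (2 + u) S →
    Σ (List ℕ) λ S′ → Zeckendorf (u + (6 + (t + t))) S′
                    × fibSum S′ ≡ fibSum S + g * lucas (3 + t + u)
                    × length S′ ≡ length S + sZ (g * lucas (3 + t))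
  appendBlock g t {S} u g≤F zS = map (u +_) B ++ S , zeckendorf-shift-++ (s≤s (s≤s z≤n)) zB zS , fibSum≡ , length≡
    where
    block = zeckendorf-exists (5 + (t + t)) (g * lucas (3 + t)) (lucasMultiple<fib {t = t} g≤F)
    B = proj₁ block
    zB = proj₁ (proj₂ block)
    fibSum-B = proj₂ (proj₂ block)
    fibSum≡ : fibSum (map (u +_) B ++ S) ≡ fibSum S + g * lucas (3 + t + u)
    fibSum≡ = begin
      fibSum (map (u +_) B ++ S)              ≡⟨ fibSum-++ (map (u +_) B) S ⟩
      fibSum (map (u +_) B) + fibSum S        ≡⟨ +-comm _ (fibSum S) ⟩
      fibSum S + fibSum (map (u +_) B)        ≡⟨ cong (fibSum S +_) (fibSum-map-+ {t = t} zB fibSum-B g≤F u) ⟩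
      fibSum S + g * lucas (3 + t + u)        ∎
      where open ≡-Reasoning
    length≡ : length (map (u +_) B ++ S) ≡ length S + sZ (g * lucas (3 + t))
    length≡ = begin
      length (map (u +_) B ++ S)              ≡⟨ length-++ (map (u +_) B) ⟩
      length (map (u +_) B) + length S        ≡⟨ +-comm _ (length S) ⟩
      length S + length (map (u +_) B)        ≡⟨ cong (length S +_) (length-map (u +_) B) ⟩
      length S + length B                     ≡⟨ cong (length S +_) (sZ-fibSum zB) ⟨
      length S + sZ (fibSum B)                ≡⟨ cong (λ x → length S + sZ x) fibSum-B ⟩
      length S + sZ (g * lucas (3 + t))       ∎
      where open ≡-Reasoning

  lucasSum : ℕ → (ℕ → ℕ) → ℕ → ℕ
  lucasSum y h zero = h 0
  lucasSum y h (suc e) = lucasSum y h e + h (suc e) * lucas (suc e * y)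

  blockDigitSum : (ℕ → ℕ) → (ℕ → ℕ) → ℕ → ℕ
  blockDigitSum h t zero = sZ (h 0)
  blockDigitSum h t (suc e) = blockDigitSum h t e + sZ (h (suc e) * lucas (3 + t (suc e)))

  -- The Zeckendorf digits of h s · L_{s y} form a block of indices within t s + 3 of s y,
  -- so separated blocks do not interact.
  module _ {y d : ℕ} {h t : ℕ → ℕ} (h≤F : ∀ s → s ≤ d → h s ≤ fib (t s))
           (separated : ∀ s → s < d → t s + t (suc s) + 4 ≤ y) where

    lucasSum-zeckendorf : ∀ e → e ≤ d → Σ (List ℕ) λ S → Zeckendorf (3 + (e * y + t e)) S
                                        × fibSum S ≡ lucasSum y h e × length S ≡ blockDigitSum h t e
    lucasSum-zeckendorf zero _ =
      let S , zS , fibSum-S = zeckendorf-exists (2 + t 0) (h 0) (≤-<-trans (h≤F 0 z≤n) (m<n+m (fib (t 0)) (0<fib-suc (t 0))))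
      in S , zS , fibSum-S , sym (trans (cong sZ (sym fibSum-S)) (sZ-fibSum zS))
    lucasSum-zeckendorf (suc e) 1+e≤d =
      let S , zS , fibSum-S , length-S = lucasSum-zeckendorf e (≤-trans (n≤1+n e) 1+e≤d)
          S′ , zS′ , fibSum-S′ , length-S′ =
            appendBlock (h (suc e)) (t (suc e)) u (h≤F (suc e) 1+e≤d) (zeckendorf-weaken (+-monoʳ-≤ 3 (m≤m+n _ z)) zS)
      in S′ , subst (λ p → Zeckendorf p S′) top≡ zS′ ,
         trans fibSum-S′ (cong₂ (λ v k → v + h (suc e) * lucas k) fibSum-S index≡) ,
         trans length-S′ (cong (_+ _) length-S)
      where
      z = proj₁ (m≤n⇒∃[o]m+o≡n (separated e 1+e≤d))
      y≡ : t e + t (suc e) + 4 + z ≡ y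
      y≡ = proj₂ (m≤n⇒∃[o]m+o≡n (separated e 1+e≤d))
      u = suc (e * y + t e + z)
      top≡ : u + (6 + (t (suc e) + t (suc e))) ≡ 3 + (suc e * y + t (suc e))
      top≡ = trans (ring (e * y) (t e) (t (suc e)) z) (cong (λ Y → 3 + (Y + e * y + t (suc e))) y≡)
        where
        ring : ∀ ey a b z → suc (ey + a + z) + (6 + (b + b)) ≡ 3 + ((a + b + 4 + z) + ey + b)
        ring = solve-∀
      index≡ : 3 + t (suc e) + u ≡ suc e * y
      index≡ = trans (ring (e * y) (t e) (t (suc e)) z) (cong (_+ e * y) y≡)
        where
        ring : ∀ ey a b z → 3 + b + suc (ey + a + z) ≡ (a + b + 4 + z) + ey
        ring = solve-∀

    sZ-lucasSum : sZ (lucasSum y h d) ≡ blockDigitSum h t d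
    sZ-lucasSum =
      let S , zS , fibSum-S , length-S = lucasSum-zeckendorf d ≤-refl
      in trans (cong sZ (sym fibSum-S)) (trans (sZ-fibSum zS) length-S)

module LucasBasis where

  open import Data.Nat as ℕ using (ℕ; zero; suc; s≤s)
  import Data.Nat.Properties as ℕ
  open import Data.Integer using (ℤ; +_; _+_; _*_; 0ℤ; 1ℤ)
  open import Data.Integer.Tactic.RingSolver using (solve-∀)
  open import Data.Vec using (Vec; []; _∷_)
  open import Relation.Binary.PropositionalEquality

  -- Coefficients of a + (n + X)·Σ g s ℓ_s in the basis (ℓ_s), for X = ℓ₁ and the
  -- Chebyshev-type products ℓ₁ℓ₀ = ℓ₁, ℓ₁ℓ₁ = ℓ₂ + 2ℓ₀, ℓ₁ℓ_{s+2} = ℓ_{s+3} + ℓ_{s+1}.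
  hornerStep : ℤ → ℕ → (ℕ → ℤ) → ℕ → ℤ
  hornerStep a n g zero = a + + n * g 0 + (g 1 + g 1)
  hornerStep a n g (suc s) = + n * g (suc s) + g s + g (2 ℕ.+ s)

  coeffs : ∀ {m} → Vec ℤ m → ℕ → ℕ → ℤ
  coeffs [] n _ = 0ℤ
  coeffs (a ∷ as) n = hornerStep a n (coeffs as n)

  coeffs-vanish : ∀ {m} (as : Vec ℤ m) n s → m ℕ.≤ s → coeffs as n s ≡ 0ℤ
  coeffs-vanish [] n s _ = refl
  coeffs-vanish (a ∷ as) n (suc s) (s≤s m≤s)
    rewrite coeffs-vanish as n (suc s) (ℕ.m≤n⇒m≤1+n m≤s) | coeffs-vanish as n s m≤s
          | coeffs-vanish as n (2 ℕ.+ s) (ℕ.m≤n⇒m≤1+n (ℕ.m≤n⇒m≤1+n m≤s)) = ring (+ n)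
    where
    ring : ∀ n → n * 0ℤ + 0ℤ + 0ℤ ≡ 0ℤ
    ring = solve-∀

  δ₀ : ℕ → ℤ
  δ₀ zero = 1ℤ
  δ₀ (suc _) = 0ℤ

  basisSum : (ℕ → ℤ) → (ℕ → ℤ) → ℕ → ℤ
  basisSum ℓ g zero = g 0 * ℓ 0
  basisSum ℓ g (suc E) = basisSum ℓ g E + g (suc E) * ℓ (suc E)

  basisSum-0 : ∀ ℓ E → basisSum ℓ (λ _ → 0ℤ) E ≡ 0ℤ
  basisSum-0 ℓ zero = refl
  basisSum-0 ℓ (suc E) rewrite basisSum-0 ℓ E = refl

  module _ (ℓ : ℕ → ℤ) (ℓ-0 : ℓ 0 ≡ 1ℤ) (ℓ-1*ℓ-1 : ℓ 1 * ℓ 1 ≡ ℓ 2 + + 2)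
           (ℓ-1*ℓ : ∀ s → ℓ 1 * ℓ (2 ℕ.+ s) ≡ ℓ (3 ℕ.+ s) + ℓ (suc s)) where

    ℓ-1*ℓ-suc : ∀ s → ℓ 1 * ℓ (suc s) ≡ ℓ (2 ℕ.+ s) + ℓ s + δ₀ s
    ℓ-1*ℓ-suc zero rewrite ℓ-1*ℓ-1 | ℓ-0 = ring (ℓ 2)
      where
      ring : ∀ x → x + + 2 ≡ x + 1ℤ + 1ℤ
      ring = solve-∀
    ℓ-1*ℓ-suc (suc s) rewrite ℓ-1*ℓ s = ring (ℓ (3 ℕ.+ s)) (ℓ (suc s))
      where
      ring : ∀ x y → x + y ≡ x + y + 0ℤ
      ring = solve-∀

    basisSum-hornerStep : ∀ a n g E → basisSum ℓ (hornerStep a n g) (suc E)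
      ≡ a + (+ n + ℓ 1) * basisSum ℓ g E + g (suc E) * (+ n * ℓ (suc E) + ℓ E + δ₀ E) + g (2 ℕ.+ E) * ℓ (suc E)
    basisSum-hornerStep a n g zero rewrite ℓ-0 = ring a (+ n) (g 0) (g 1) (g 2) (ℓ 1)
      where
      ring : ∀ a n g₀ g₁ g₂ l → (a + n * g₀ + (g₁ + g₁)) * 1ℤ + (n * g₁ + g₀ + g₂) * l
                               ≡ a + (n + l) * (g₀ * 1ℤ) + g₁ * (n * l + 1ℤ + 1ℤ) + g₂ * l
      ring = solve-∀
    basisSum-hornerStep a n g (suc E) = begin
      basisSum ℓ (hornerStep a n g) (suc E) + hornerStep a n g (2 ℕ.+ E) * ℓ (2 ℕ.+ E)
        ≡⟨ cong (_+ hornerStep a n g (2 ℕ.+ E) * ℓ (2 ℕ.+ E)) (basisSum-hornerStep a n g E) ⟩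
      a + (+ n + ℓ 1) * basisSum ℓ g E + g (suc E) * (+ n * ℓ (suc E) + ℓ E + δ₀ E) + g (2 ℕ.+ E) * ℓ (suc E)
        + (+ n * g (2 ℕ.+ E) + g (suc E) + g (3 ℕ.+ E)) * ℓ (2 ℕ.+ E)
        ≡⟨ ring₁ a (+ n) (basisSum ℓ g E) (g (suc E)) (g (2 ℕ.+ E)) (g (3 ℕ.+ E)) (ℓ 1) (ℓ E) (ℓ (suc E)) (ℓ (2 ℕ.+ E)) (δ₀ E) ⟩
      a + (+ n + ℓ 1) * basisSum ℓ g E + g (suc E) * (+ n * ℓ (suc E) + (ℓ (2 ℕ.+ E) + ℓ E + δ₀ E))
        + g (2 ℕ.+ E) * (+ n * ℓ (2 ℕ.+ E) + ℓ (suc E) + 0ℤ) + g (3 ℕ.+ E) * ℓ (2 ℕ.+ E)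
        ≡⟨ cong (λ x → a + (+ n + ℓ 1) * basisSum ℓ g E + g (suc E) * (+ n * ℓ (suc E) + x)
                         + g (2 ℕ.+ E) * (+ n * ℓ (2 ℕ.+ E) + ℓ (suc E) + 0ℤ) + g (3 ℕ.+ E) * ℓ (2 ℕ.+ E))
                (ℓ-1*ℓ-suc E) ⟨
      a + (+ n + ℓ 1) * basisSum ℓ g E + g (suc E) * (+ n * ℓ (suc E) + ℓ 1 * ℓ (suc E))
        + g (2 ℕ.+ E) * (+ n * ℓ (2 ℕ.+ E) + ℓ (suc E) + 0ℤ) + g (3 ℕ.+ E) * ℓ (2 ℕ.+ E)
        ≡⟨ ring₂ a (+ n) (basisSum ℓ g E) (g (suc E)) (ℓ 1) (ℓ (suc E)) _ _ ⟩
      a + (+ n + ℓ 1) * (basisSum ℓ g E + g (suc E) * ℓ (suc E))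
        + g (2 ℕ.+ E) * (+ n * ℓ (2 ℕ.+ E) + ℓ (suc E) + 0ℤ) + g (3 ℕ.+ E) * ℓ (2 ℕ.+ E)
        ∎
      where
      open ≡-Reasoning
      ring₁ : ∀ a n Σ g₁ g₂ g₃ l₁ l l′ l″ e →
        a + (n + l₁) * Σ + g₁ * (n * l′ + l + e) + g₂ * l′ + (n * g₂ + g₁ + g₃) * l″
        ≡ a + (n + l₁) * Σ + g₁ * (n * l′ + (l″ + l + e)) + g₂ * (n * l″ + l′ + 0ℤ) + g₃ * l″
      ring₁ = solve-∀
      ring₂ : ∀ a n Σ g₁ l₁ l′ X Y →
        a + (n + l₁) * Σ + g₁ * (n * l′ + l₁ * l′) + X + Y ≡ a + (n + l₁) * (Σ + g₁ * l′) + X + Y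
      ring₂ = solve-∀

    basisSum-hornerStep-vanishing : ∀ a n g E → g (suc E) ≡ 0ℤ → g (2 ℕ.+ E) ≡ 0ℤ
                            → basisSum ℓ (hornerStep a n g) (suc E) ≡ a + (+ n + ℓ 1) * basisSum ℓ g E
    basisSum-hornerStep-vanishing a n g E g₁≡0 g₂≡0 rewrite basisSum-hornerStep a n g E | g₁≡0 | g₂≡0 =
      ring a (+ n + ℓ 1) (basisSum ℓ g E) (+ n * ℓ (suc E) + ℓ E + δ₀ E) (ℓ (suc E))
      where
      ring : ∀ a x Σ y z → a + x * Σ + 0ℤ * y + 0ℤ * z ≡ a + x * Σ
      ring = solve-∀

    evalPoly≡basisSum : ∀ {m} E (as : Vec ℤ m) n → m ℕ.≤ suc E → evalPoly as (+ n + ℓ 1) ≡ basisSum ℓ (coeffs as n) E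
    evalPoly≡basisSum E [] n _ = sym (basisSum-0 ℓ E)
    evalPoly≡basisSum zero (a ∷ []) n _ rewrite ℓ-0 = ring a (+ n + ℓ 1) (+ n)
      where
      ring : ∀ a x n → a + x * 0ℤ ≡ (a + n * 0ℤ + (0ℤ + 0ℤ)) * 1ℤ
      ring = solve-∀
    evalPoly≡basisSum zero (a ∷ _ ∷ _) n (s≤s ())
    evalPoly≡basisSum (suc E) (a ∷ as) n (s≤s m≤1+E) = begin
      a + (+ n + ℓ 1) * evalPoly as (+ n + ℓ 1)
        ≡⟨ cong (λ x → a + (+ n + ℓ 1) * x) (evalPoly≡basisSum E as n m≤1+E) ⟩
      a + (+ n + ℓ 1) * basisSum ℓ (coeffs as n) E
        ≡⟨ basisSum-hornerStep-vanishing a n (coeffs as n) E (coeffs-vanish as n (suc E) m≤1+E)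
                                         (coeffs-vanish as n (2 ℕ.+ E) (ℕ.m≤n⇒m≤1+n m≤1+E)) ⟨
      basisSum ℓ (coeffs (a ∷ as) n) (suc E)
        ∎
      where open ≡-Reasoning

module CoefficientBounds where

  open Fibonacci
  open Zeckendorf using (n<m⇒m∸n≡1+[m∸1+n])
  open LucasBasis using (hornerStep; coeffs)
  open import Data.Nat
  open import Data.Nat.Properties
  open import Data.Nat.Tactic.RingSolver using (solve-∀)
  open import Data.Integer as ℤ using (ℤ; +_; -[1+_]; ∣_∣)
  import Data.Integer.Properties as ℤ
  open import Data.Vec using (Vec; []; _∷_; last; map; sum)
  open import Data.Vec.Relation.Unary.All as All using (All; []; _∷_)
  open import Data.Product using (Σ; _×_; _,_; proj₁; proj₂)
  open import Relation.Binary.PropositionalEquality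

  i+n∈[1,M+n] : ∀ i {M} n → ∣ i ∣ ≤ M → M < n → Σ ℕ λ v → i ℤ.+ + n ≡ + v × 1 ≤ v × v ≤ M + n
  i+n∈[1,M+n] (+ p) n p≤M M<n = p + n , refl , ≤-trans (≤-trans (s≤s z≤n) M<n) (m≤n+m n p) , +-monoˡ-≤ n p≤M
  i+n∈[1,M+n] -[1+ p ] {M} n 1+p≤M M<n =
    n ∸ suc p , ℤ.⊖-≥ (<⇒≤ 1+p<n) , m<n⇒0<n∸m 1+p<n , ≤-trans (m∸n≤m n (suc p)) (m≤n+m n M)
    where
    1+p<n : suc p < n
    1+p<n = ≤-<-trans 1+p≤M M<n

  absSum : ∀ {m} → Vec ℤ m → ℕ
  absSum α = sum (map ∣_∣ α)

  ∣∣≤absSum : ∀ {m} (α : Vec ℤ m) → All (λ a → ∣ a ∣ ≤ absSum α) α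
  ∣∣≤absSum [] = []
  ∣∣≤absSum (a ∷ α) =
    m≤m+n ∣ a ∣ (absSum α) ∷ All.map (λ ∣x∣≤ → ≤-trans ∣x∣≤ (m≤n+m _ ∣ a ∣)) (∣∣≤absSum α)

  coeffBound : ℕ → ℕ → ℕ
  coeffBound M zero = 1
  coeffBound M (suc e) = M + 3 * coeffBound M e

  -- h-bound says h s ≤ coeffBound M e · n^(e − s), stated without truncated subtraction.
  record NatCoeffs (M n e : ℕ) (g : ℕ → ℤ) : Set where
    field
      h : ℕ → ℕ
      g≡h : ∀ s → g s ≡ + h s
      1≤h-0 : 1 ≤ h 0
      h-bound : ∀ s → h s * n ^ s ≤ coeffBound M e * n ^ e

  natCoeffs-monic : ∀ M n → NatCoeffs M n 0 (hornerStep ℤ.1ℤ n (λ _ → + 0))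
  natCoeffs-monic M n = record { h = h ; g≡h = g≡h ; 1≤h-0 = ≤-refl ; h-bound = h-bound }
    where
    h : ℕ → ℕ
    h zero = 1
    h (suc s) = 0
    g≡h : ∀ s → hornerStep ℤ.1ℤ n (λ _ → + 0) s ≡ + h s
    g≡h zero rewrite ℤ.*-zeroʳ (+ n) = refl
    g≡h (suc s) rewrite ℤ.*-zeroʳ (+ n) = refl
    h-bound : ∀ s → h s * n ^ s ≤ 1 * 1
    h-bound zero = ≤-refl
    h-bound (suc s) = z≤n

  module _ {n e K : ℕ} ⦃ _ : NonZero n ⦄ (h : ℕ → ℕ) (h-bound : ∀ s → h s * n ^ s ≤ K * n ^ e) where

    K*n^e≤K*n^[1+e] : K * n ^ e ≤ K * (n * n ^ e)
    K*n^e≤K*n^[1+e] = *-monoʳ-≤ K (m≤n*m (n ^ e) n)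

    hornerStep-0-bound : n * h 0 + (h 1 + h 1) ≤ 3 * K * (n * n ^ e)
    hornerStep-0-bound = begin
      n * h 0 + (h 1 + h 1)                                         ≤⟨ +-mono-≤ (*-monoʳ-≤ n h-0≤) (+-mono-≤ h-1≤ h-1≤) ⟩
      n * (K * n ^ e) + (K * (n * n ^ e) + K * (n * n ^ e))         ≡⟨ ring n K (n ^ e) ⟩
      3 * K * (n * n ^ e)                                           ∎
      where
      open ≤-Reasoning
      h-0≤ : h 0 ≤ K * n ^ e
      h-0≤ = ≤-trans (≤-reflexive (sym (*-identityʳ (h 0)))) (h-bound 0)
      h-1≤ : h 1 ≤ K * (n * n ^ e)
      h-1≤ = ≤-trans (≤-trans (m≤m*n (h 1) (n ^ 1) ⦃ m^n≢0 n 1 ⦄) (h-bound 1)) K*n^e≤K*n^[1+e]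
      ring : ∀ n K P → n * (K * P) + (K * (n * P) + K * (n * P)) ≡ 3 * K * (n * P)
      ring = solve-∀

    hornerStep-suc-bound : ∀ s → (n * h (suc s) + h s + h (2 + s)) * (n * n ^ s) ≤ 3 * K * (n * n ^ e)
    hornerStep-suc-bound s = begin
      (n * h (suc s) + h s + h (2 + s)) * (n * n ^ s)
        ≡⟨ ring₁ n (h (suc s)) (h s) (h (2 + s)) (n ^ s) ⟩
      n * (h (suc s) * (n * n ^ s)) + n * (h s * n ^ s) + h (2 + s) * (n * n ^ s)
        ≤⟨ +-mono-≤ (+-mono-≤ (*-monoʳ-≤ n (h-bound (suc s))) (*-monoʳ-≤ n (h-bound s))) h-2+s≤ ⟩
      n * (K * n ^ e) + n * (K * n ^ e) + K * n ^ e
        ≤⟨ +-monoʳ-≤ (n * (K * n ^ e) + n * (K * n ^ e)) K*n^e≤K*n^[1+e] ⟩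
      n * (K * n ^ e) + n * (K * n ^ e) + K * (n * n ^ e)
        ≡⟨ ring₂ n K (n ^ e) ⟩
      3 * K * (n * n ^ e)
        ∎
      where
      open ≤-Reasoning
      h-2+s≤ : h (2 + s) * (n * n ^ s) ≤ K * n ^ e
      h-2+s≤ = ≤-trans (*-monoʳ-≤ (h (2 + s)) (m≤n*m (n * n ^ s) n)) (h-bound (2 + s))
      ring₁ : ∀ n a b c p → (n * a + b + c) * (n * p) ≡ n * (a * (n * p)) + n * (b * p) + c * (n * p)
      ring₁ = solve-∀
      ring₂ : ∀ n K P → n * (K * P) + n * (K * P) + K * (n * P) ≡ 3 * K * (n * P)
      ring₂ = solve-∀

  natCoeffs-step : ∀ {M n e g} a → ∣ a ∣ ≤ M → M < n → NatCoeffs M n e g → NatCoeffs M n (suc e) (hornerStep a n g)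
  natCoeffs-step {M} {n} {e} {g} a ∣a∣≤M M<n G =
    record { h = h′ ; g≡h = g≡h′ ; 1≤h-0 = proj₁ (proj₂ (proj₂ a+k)) ; h-bound = h′-bound }
    where
    open NatCoeffs G
    instance
      n≢0 : NonZero n
      n≢0 = >-nonZero (≤-<-trans z≤n M<n)
    K = coeffBound M e
    Q = n * n ^ e
    k = n * h 0 + (h 1 + h 1)
    M<k : M < k
    M<k = <-≤-trans M<n (≤-trans (m≤m*n n (h 0) ⦃ >-nonZero 1≤h-0 ⦄) (m≤m+n _ _))
    a+k = i+n∈[1,M+n] a k ∣a∣≤M M<k

    h′ : ℕ → ℕ
    h′ zero = proj₁ a+k
    h′ (suc s) = n * h (suc s) + h s + h (2 + s)

    g≡h′ : ∀ s → hornerStep a n g s ≡ + h′ s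
    g≡h′ zero rewrite g≡h 0 | g≡h 1 | sym (ℤ.pos-* n (h 0)) =
      trans (ℤ.+-assoc a (+ (n * h 0)) (+ (h 1 + h 1))) (proj₁ (proj₂ a+k))
    g≡h′ (suc s) rewrite g≡h s | g≡h (suc s) | g≡h (2 + s) | sym (ℤ.pos-* n (h (suc s))) = refl

    3KQ≤[M+3K]Q : 3 * K * Q ≤ (M + 3 * K) * Q
    3KQ≤[M+3K]Q = *-monoˡ-≤ Q (m≤n+m (3 * K) M)

    h′-bound : ∀ s → h′ s * n ^ s ≤ (M + 3 * K) * Q
    h′-bound zero = begin
      h′ 0 * 1                          ≡⟨ *-identityʳ (h′ 0) ⟩
      h′ 0                              ≤⟨ proj₂ (proj₂ (proj₂ a+k)) ⟩
      M + k                             ≤⟨ +-mono-≤ (m≤m*n M Q ⦃ m^n≢0 n (suc e) ⦄)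
                                                     (hornerStep-0-bound {e = e} {K} h h-bound) ⟩
      M * Q + 3 * K * Q                 ≡⟨ *-distribʳ-+ Q M (3 * K) ⟨
      (M + 3 * K) * Q                   ∎
      where open ≤-Reasoning
    h′-bound (suc s) = ≤-trans (hornerStep-suc-bound {e = e} {K} h h-bound s) 3KQ≤[M+3K]Q

  natCoeffs : ∀ {M n} e (α : Vec ℤ (suc e)) → last α ≡ ℤ.1ℤ → All (λ a → ∣ a ∣ ≤ M) α → M < n
            → NatCoeffs M n e (coeffs α n)
  natCoeffs {M} {n} zero (a ∷ []) refl _ _ = natCoeffs-monic M n
  natCoeffs (suc e) (a ∷ α) last≡1 (∣a∣≤M ∷ ∣α∣≤M) M<n =
    natCoeffs-step a ∣a∣≤M M<n (natCoeffs e α last≡1 ∣α∣≤M M<n)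

  natCoeff≤fib : ∀ {M n d g} (G : NatCoeffs M n d g) → 0 < n → ∀ {a} → n < fib a → ∀ s → s ≤ d
               → NatCoeffs.h G s ≤ fib (2 + coeffBound M d + (d ∸ s) * a)
  natCoeff≤fib {M} {n} {d} G 0<n {a} n<F s s≤d = begin
    h s                                    ≤⟨ *-cancelʳ-≤ (h s) (K * n ^ w) (n ^ s) h*n^s≤ ⟩
    K * n ^ w                              ≤⟨ *-mono-≤ (n≤fib[2+n] K) (≤-trans (^-monoˡ-≤ w (<⇒≤ n<F)) (fib^≤fib a w)) ⟩
    fib (2 + K) * fib (suc (w * a))        ≤⟨ fib*fib≤fib-+ (2 + K) (w * a) ⟩
    fib (2 + K + w * a)                    ∎
    where
    open ≤-Reasoning
    open NatCoeffs G
    K = coeffBound M d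
    w = d ∸ s
    instance
      n^s≢0 : NonZero (n ^ s)
      n^s≢0 = m^n≢0 n s ⦃ >-nonZero 0<n ⦄
    h*n^s≤ : h s * n ^ s ≤ K * n ^ w * n ^ s
    h*n^s≤ = ≤-trans (h-bound s) (≤-reflexive (trans (cong (λ e → K * n ^ e) (sym (m+[n∸m]≡n s≤d)))
                       (trans (cong (K *_) (^-distribˡ-+-* n s w)) (ring K (n ^ s) (n ^ w)))))
      where
      ring : ∀ K p q → K * (p * q) ≡ K * q * p
      ring = solve-∀

  separated : ∀ {c a d j} → 2 * c + 2 ≤ a → d * a + 1 ≤ j → ∀ s → s < d
            → c + (d ∸ s) * a + (c + (d ∸ suc s) * a) + 4 ≤ 2 * j
  separated {c} {a} {d} {j} 2c+2≤a da+1≤j s s<d = begin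
    c + (d ∸ s) * a + (c + w * a) + 4       ≡⟨ cong (λ x → c + x * a + (c + w * a) + 4) d∸s≡1+w ⟩
    c + suc w * a + (c + w * a) + 4         ≡⟨ ring₁ c a (w * a) ⟩
    (2 * c + 2) + (2 + (a + 2 * (w * a)))   ≤⟨ +-monoˡ-≤ _ 2c+2≤a ⟩
    a + (2 + (a + 2 * (w * a)))             ≡⟨ ring₂ a (w * a) ⟩
    2 * (suc w * a + 1)                     ≤⟨ *-monoʳ-≤ 2 (+-monoˡ-≤ 1 (*-monoˡ-≤ a 1+w≤d)) ⟩
    2 * (d * a + 1)                         ≤⟨ *-monoʳ-≤ 2 da+1≤j ⟩
    2 * j                                   ∎
    where
    open ≤-Reasoning
    w = d ∸ suc s
    d∸s≡1+w : d ∸ s ≡ suc w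
    d∸s≡1+w = n<m⇒m∸n≡1+[m∸1+n] s<d
    1+w≤d : suc w ≤ d
    1+w≤d = subst (_≤ d) d∸s≡1+w (m∸n≤m d s)
    ring₁ : ∀ c a wa → c + (a + wa) + (c + wa) + 4 ≡ (2 * c + 2) + (2 + (a + 2 * wa))
    ring₁ = solve-∀
    ring₂ : ∀ a wa → a + (2 + (a + 2 * wa)) ≡ 2 * ((a + wa) + 1)
    ring₂ = solve-∀

module Stability where

  open FibonacciIdentities using (lucas*lucas; -1^even≡1)
  open LucasSums
  open LucasBasis
  open CoefficientBounds
  open import Data.Nat as ℕ using (ℕ; zero; suc; _∸_; z≤n; s≤s)
  import Data.Nat.Properties as ℕ
  open import Data.Integer using (ℤ; +_; _+_; _*_; 1ℤ; ∣_∣)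
  open import Data.Integer.Properties using (*-identityˡ; *-identityʳ; pos-+; pos-*)
  open import Data.Vec using (Vec; last)
  open import Data.Vec.Relation.Unary.All using (All)
  open import Data.Product using (Σ; _,_)
  open import Relation.Binary.PropositionalEquality

  -- The basis of the paper, with ℓ₀ = 1 rather than L₀ = 2.
  lucasBasis : ℕ → ℕ → ℤ
  lucasBasis y zero = 1ℤ
  lucasBasis y (suc s) = + lucas (suc s ℕ.* y)

  lucasBasis-1*1 : ∀ j → let y = 2 ℕ.* j in lucasBasis y 1 * lucasBasis y 1 ≡ lucasBasis y 2 + + 2
  lucasBasis-1*1 j =
    trans (cong (λ k → + lucas k * lucasBasis y 1) (ℕ.+-identityʳ y))
      (trans (lucas*lucas y 0) (cong (λ x → lucasBasis y 2 + x * + 2) (-1^even≡1 j)))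
    where y = 2 ℕ.* j

  lucasBasis-1*ℓ : ∀ j → let y = 2 ℕ.* j in
    ∀ s → lucasBasis y 1 * lucasBasis y (2 ℕ.+ s) ≡ lucasBasis y (3 ℕ.+ s) + lucasBasis y (suc s)
  lucasBasis-1*ℓ j s =
    trans (cong (λ k → + lucas k * lucasBasis y (2 ℕ.+ s)) (ℕ.+-identityʳ y))
      (trans (lucas*lucas y (suc s ℕ.* y))
        (cong (λ x → lucasBasis y (3 ℕ.+ s) + x) (trans (cong (_* lucasBasis y (suc s)) (-1^even≡1 j)) (*-identityˡ _))))
    where y = 2 ℕ.* j

  basisSum-lucasBasis : ∀ y {g h} → (∀ s → g s ≡ + h s) → ∀ e → basisSum (lucasBasis y) g e ≡ + lucasSum y h e
  basisSum-lucasBasis y {g} {h} g≡h zero = trans (*-identityʳ (g 0)) (g≡h 0)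
  basisSum-lucasBasis y {g} {h} g≡h (suc e) =
    trans (cong₂ (λ u v → u + v * + lucas (suc e ℕ.* y)) (basisSum-lucasBasis y g≡h e) (g≡h (suc e)))
      (trans (cong (λ x → + lucasSum y h e + x) (sym (pos-* (h (suc e)) _))) (sym (pos-+ (lucasSum y h e) _)))

  sZ-evalPoly-stable : ∀ {d M n a} (α : Vec ℤ (suc d)) → last α ≡ 1ℤ → All (λ x → ∣ x ∣ ℕ.≤ M) α → M ℕ.< n
    → n ℕ.< fib a → 2 ℕ.* (2 ℕ.+ coeffBound M d) ℕ.+ 2 ℕ.≤ a
    → Σ ℕ λ c → ∀ j → d ℕ.* a ℕ.+ 1 ℕ.≤ j → sZ ∣ evalPoly α (+ (n ℕ.+ lucas (2 ℕ.* j))) ∣ ≡ c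
  sZ-evalPoly-stable {d} {M} {n} {a} α last≡1 ∣α∣≤M M<n n<F c₀≤a = blockDigitSum h t d , digitSum≡
    where
    G = natCoeffs d α last≡1 ∣α∣≤M M<n
    open NatCoeffs G
    t : ℕ → ℕ
    t s = 2 ℕ.+ coeffBound M d ℕ.+ (d ∸ s) ℕ.* a
    evalPoly≡lucasSum : ∀ j → evalPoly α (+ (n ℕ.+ lucas (2 ℕ.* j))) ≡ + lucasSum (2 ℕ.* j) h d
    evalPoly≡lucasSum j = begin
      evalPoly α (+ (n ℕ.+ lucas y))             ≡⟨ cong (evalPoly α) (trans (pos-+ n (lucas y))
                                                      (cong (λ k → + n + + lucas k) (sym (ℕ.+-identityʳ y)))) ⟩
      evalPoly α (+ n + lucasBasis y 1)          ≡⟨ evalPoly≡basisSum (lucasBasis y) refl (lucasBasis-1*1 j) (lucasBasis-1*ℓ j)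
                                                                      d α n ℕ.≤-refl ⟩
      basisSum (lucasBasis y) (coeffs α n) d     ≡⟨ basisSum-lucasBasis y g≡h d ⟩
      + lucasSum y h d                           ∎
      where
      open ≡-Reasoning
      y = 2 ℕ.* j
    digitSum≡ : ∀ j → d ℕ.* a ℕ.+ 1 ℕ.≤ j → sZ ∣ evalPoly α (+ (n ℕ.+ lucas (2 ℕ.* j))) ∣ ≡ blockDigitSum h t d
    digitSum≡ j da+1≤j =
      trans (cong (λ x → sZ ∣ x ∣) (evalPoly≡lucasSum j))
        (sZ-lucasSum (natCoeff≤fib G (ℕ.≤-trans (s≤s z≤n) M<n) n<F)
                     (separated {c = 2 ℕ.+ coeffBound M d} c₀≤a da+1≤j))

open CoefficientBounds using (absSum; ∣∣≤absSum; coeffBound)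
open Stability using (sZ-evalPoly-stable)
open import Data.Nat using (ℕ; suc; _+_; _*_; _<_; _≤_; z≤n; s≤s; >-nonZero)
open import Data.Nat.Properties using (≤-refl; ≤-trans; <-trans; n<1+n; m≤n*m; +-monoʳ-≤; <⇒≤)
open import Data.Nat.Tactic.RingSolver using (solve-∀)
open import Data.Integer as ℤ using (ℤ; +_)
open import Data.Vec using (Vec; last)
open import Data.Product using (Σ; ∃; _×_; _,_)
open import Relation.Binary.PropositionalEquality using (_≡_; trans; sym; cong)

lemma2p10 : (d : ℕ) → 2 ≤ d → (α : Vec ℤ (suc d)) → last α ≡ ℤ.1ℤ
    → ((m : ℕ) → ∃ λ (v : ℕ) → evalPoly α (+ m) ≡ + v)
    → (μ : ℕ) → 1 ≤ μ
    → Σ ℕ λ C → 0 < C × Σ ℕ λ k₀ → (k r n : ℕ) → k₀ ≤ k → 1 < r → C < n → n < fib (μ * k)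
    → sZ (ℤ.∣ evalPoly α (+ (n + lucas (2 * d * μ * k + 2))) ∣)
    ≡ sZ (ℤ.∣ evalPoly α (+ (n + lucas (2 * d * μ * k + 2 * r))) ∣)
lemma2p10 d _ α last≡1 _ μ 1≤μ = suc M , s≤s z≤n , k₀ , digitSums≡
  where
  M = absSum α
  k₀ = 2 * (2 + coeffBound M d) + 2
  digitSums≡ : (k r n : ℕ) → k₀ ≤ k → 1 < r → suc M < n → n < fib (μ * k)
    → sZ (ℤ.∣ evalPoly α (+ (n + lucas (2 * d * μ * k + 2))) ∣)
    ≡ sZ (ℤ.∣ evalPoly α (+ (n + lucas (2 * d * μ * k + 2 * r))) ∣)
  digitSums≡ k r n k₀≤k 1<r C<n n<F =
    let c , digitSum≡c = sZ-evalPoly-stable α last≡1 (∣∣≤absSum α) (<-trans (n<1+n M) C<n) n<F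
                           (≤-trans k₀≤k (m≤n*m k μ ⦃ >-nonZero 1≤μ ⦄))
        digitSum[2x]≡c : ∀ x → 1 ≤ x → sZ (ℤ.∣ evalPoly α (+ (n + lucas (2 * d * μ * k + 2 * x))) ∣) ≡ c
        digitSum[2x]≡c x 1≤x = trans (cong (λ i → sZ (ℤ.∣ evalPoly α (+ (n + lucas i)) ∣)) (index≡ d μ k x))
                                     (digitSum≡c (d * (μ * k) + x) (+-monoʳ-≤ (d * (μ * k)) 1≤x))
    in trans (digitSum[2x]≡c 1 ≤-refl) (sym (digitSum[2x]≡c r (<⇒≤ 1<r)))
    where
    index≡ : ∀ d μ k x → 2 * d * μ * k + 2 * x ≡ 2 * (d * (μ * k) + x)
    index≡ = solve-∀
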